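{- Let $\preceq$ be a linear order on the set of primes. For any integers $a, a' \ge 2$, if $L_a \cap L_{a'} \ne \varnothing$, then $a \in L_{a'}$ or $a' \in L_a$.
   Context: For $n \ge 2$, $p'(n)$ and $P'(n)$ denote the $\preceq$-minimal and $\preceq$-maximal prime divisors of $n$; $p'(1) = +\infty$, meaning that $P'(a) \preceq p'(1)$ for all $a$. For $a \ge 2$, $L_a = \{ab : b \in \mathbb{N},\ P'(a) \preceq p'(b)\}$. -}

module Defs where

open import Level using (0ℓ)
open import Data.Nat using (ℕ; _*_; _≥_)
open import Data.Nat.Divisibility using (_∣_)
open import Data.Nat.Primality using (Prime)
open import Data.Product using (Σ; ∃; _×_; _,_)
open import Data.Sum using (_⊎_)
open import Relation.Binary.PropositionalEquality using (_≡_)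

record LinearOrderOnPrimes (_≼_ : ℕ → ℕ → Set) : Set where
  field
    reflexive : ∀ {p} → Prime p → p ≼ p
    antisym   : ∀ {p q} → Prime p → Prime q → p ≼ q → q ≼ p → p ≡ q
    trans     : ∀ {p q r} → Prime p → Prime q → Prime r → p ≼ q → q ≼ r → p ≼ r
    total     : ∀ {p q} → Prime p → Prime q → (p ≼ q) ⊎ (q ≼ p)

module _ (_≼_ : ℕ → ℕ → Set) where

  IsMinPrimeDiv : ℕ → ℕ → Set
  IsMinPrimeDiv n p = Prime p × p ∣ n × (∀ q → Prime q → q ∣ n → p ≼ q)

  IsMaxPrimeDiv : ℕ → ℕ → Set
  IsMaxPrimeDiv n p = Prime p × p ∣ n × (∀ q → Prime q → q ∣ n → q ≼ p)

  -- P'(a) ≼ p'(b), with the convention p'(1) = +∞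
  MaxBelowMin : ℕ → ℕ → Set
  MaxBelowMin a b = b ≡ 1 ⊎ (∃ λ p → ∃ λ q → IsMaxPrimeDiv a p × IsMinPrimeDiv b q × p ≼ q)

  -- n ∈ L_a = { a b : b ∈ ℕ (b ≥ 1), P'(a) ≼ p'(b) }
  InL : ℕ → ℕ → Set
  InL a n = ∃ λ b → b ≥ 1 × n ≡ a * b × MaxBelowMin a b

{-# OPTIONS --safe #-}
-- Write a = x g and a' = y g with g = gcd a a' and x, y coprime. Cancelling g from a b = a' b'
-- gives x b = y b', hence x ∣ b' and y ∣ b. If x and y had prime factors q and r, then
-- q ≼ P'(a) ≼ p'(b) ≼ r and r ≼ P'(a') ≼ p'(b') ≼ q, so q = r would divide both x and y.
-- So x = 1, and a' = a y with y ∣ b, whose prime factors all lie above P'(a); or symmetrically y = 1.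
module Submission where

open import Defs
open import Data.Nat using (ℕ; _≥_)
open import Data.Product using (∃; _×_; _,_)
open import Data.Sum using (_⊎_; inj₁; inj₂)

import Algebra.Properties.CommutativeSemigroup as CommSemigroupProperties
open import Data.Empty using (⊥-elim)
open import Data.List.Base using ([]; _∷_)
open import Data.List.Membership.Propositional using (_∈_)
open import Data.List.Relation.Unary.All as All using (All; []; _∷_)
open import Data.List.Relation.Unary.Any using (here; there)
open import Data.Nat.Base using (suc; _*_; _/_; NonZero; ≢-nonZero; ≢-nonZero⁻¹; >-nonZero; s≤s; z≤n)
open import Data.Nat.Coprimality as Coprimality using (Coprime; coprime-/gcd; coprime-divisor)
open import Data.Nat.DivMod using (m/n*n≡m)
open import Data.Nat.Divisibility
open import Data.Nat.GCD using (gcd; gcd[m,n]∣m; gcd[m,n]∣n; gcd[m,n]≢0)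
open import Data.Nat.ListAction.Properties using (∈⇒∣product)
open import Data.Nat.Primality using (Prime; ¬prime[1])
open import Data.Nat.Primality.Factorisation
open import Data.Nat.Properties
open import Relation.Binary.PropositionalEquality
open import Relation.Nullary using (¬_)

open CommSemigroupProperties *-commutativeSemigroup using (xy∙z≈xz∙y)

prime∤1 : ∀ {p} → Prime p → ¬ p ∣ 1
prime∤1 pp p∣1 = ¬prime[1] (subst Prime (∣1⇒≡1 p∣1) pp)

coprime-cofactors : ∀ a a' {b b'} .{{_ : NonZero a}} → a * b ≡ a' * b' →
                    ∃ λ x → ∃ λ y → Coprime x y × x ∣ a × y ∣ a' × x ∣ b' × y ∣ b × a * y ≡ a' * x
coprime-cofactors a a' {b} {b'} ab≡a'b' =
  x , y , x⊥y , m/n∣m g∣a , m/n∣m g∣a' ,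
  coprime-divisor x⊥y (divides b (trans (sym xb≡yb') (*-comm x b))) ,
  coprime-divisor (Coprimality.sym x⊥y) (divides b' (trans xb≡yb' (*-comm y b'))) ,
  ay≡a'x
  where
  open ≡-Reasoning
  g = gcd a a'
  instance _ : NonZero g
           _ = ≢-nonZero (gcd[m,n]≢0 a a' (inj₁ (≢-nonZero⁻¹ a)))
  g∣a = gcd[m,n]∣m a a'
  g∣a' = gcd[m,n]∣n a a'
  x = a / g
  y = a' / g
  x⊥y : Coprime x y
  x⊥y = coprime-/gcd a a'
  xb≡yb' : x * b ≡ y * b'
  xb≡yb' = *-cancelʳ-≡ (x * b) (y * b') g (begin
    x * b * g   ≡⟨ xy∙z≈xz∙y x b g ⟩
    x * g * b   ≡⟨ cong (_* b) (m/n*n≡m g∣a) ⟩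
    a * b       ≡⟨ ab≡a'b' ⟩
    a' * b'     ≡⟨ cong (_* b') (m/n*n≡m g∣a') ⟨
    y * g * b'  ≡⟨ xy∙z≈xz∙y y g b' ⟩
    y * b' * g  ∎)
  ay≡a'x : a * y ≡ a' * x
  ay≡a'x = begin
    a * y       ≡⟨ cong (_* y) (m/n*n≡m g∣a) ⟨
    x * g * y   ≡⟨ xy∙z≈xz∙y x g y ⟩
    x * y * g   ≡⟨ cong (_* g) (*-comm x y) ⟩
    y * x * g   ≡⟨ xy∙z≈xz∙y y g x ⟨
    y * g * x   ≡⟨ cong (_* x) (m/n*n≡m g∣a') ⟩
    a' * x      ∎

module _ {_≼_ : ℕ → ℕ → Set} (≼-linear : LinearOrderOnPrimes _≼_) where
  open LinearOrderOnPrimes ≼-linear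
    renaming (reflexive to ≼-refl; antisym to ≼-antisym; trans to ≼-trans; total to ≼-total)

  ≼-minimum : ∀ {x xs} → All Prime (x ∷ xs) → ∃ λ m → m ∈ x ∷ xs × All (m ≼_) (x ∷ xs)
  ≼-minimum {x} {[]} (px ∷ []) = x , here refl , ≼-refl px ∷ []
  ≼-minimum {x} {_ ∷ _} (px ∷ pxs) with m , m∈xs , m≼xs ← ≼-minimum pxs
    with pm ← All.lookup pxs m∈xs | ≼-total px pm
  ... | inj₁ x≼m =
    x , here refl , ≼-refl px ∷ All.zipWith (λ (pz , m≼z) → ≼-trans px pm pz x≼m m≼z) (pxs , m≼xs)
  ... | inj₂ m≼x = m , there m∈xs , m≼x ∷ m≼xs

  minPrimeDiv : ∀ {n} → n ≥ 2 → ∃ (IsMinPrimeDiv _≼_ n)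
  minPrimeDiv {n} (s≤s (s≤s _)) with factorise n
  ... | record { factors = [] ; isFactorisation = () }
  ... | record { factors = _ ∷ _ ; isFactorisation = n≡Πps ; factorsPrime = pps }
    with m , m∈ps , m≼ps ← ≼-minimum pps
    = m , All.lookup pps m∈ps , subst (m ∣_) (sym n≡Πps) (∈⇒∣product m∈ps) , m≼prime-divisors
    where
    m≼prime-divisors : ∀ q → Prime q → q ∣ n → m ≼ q
    m≼prime-divisors q pq q∣n =
      All.lookup m≼ps (factorisationHasAllPrimeFactors pq (subst (q ∣_) n≡Πps q∣n) pps)

  maxBelowMin⇒≼ : ∀ {a b p q} → MaxBelowMin _≼_ a b → Prime p → Prime q → p ∣ a → q ∣ b → p ≼ q
  maxBelowMin⇒≼ (inj₁ refl) _ pq _ q∣1 = ⊥-elim (prime∤1 pq q∣1)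
  maxBelowMin⇒≼ (inj₂ (P , p' , (pP , _ , maxP) , (pp' , _ , minp') , P≼p')) pp pq p∣a q∣b =
    ≼-trans pp pP pq (maxP _ pp p∣a) (≼-trans pP pp' pq P≼p' (minp' _ pq q∣b))

  maxBelowMin-∣ʳ : ∀ {a b d} → MaxBelowMin _≼_ a b → d ∣ b → MaxBelowMin _≼_ a d
  maxBelowMin-∣ʳ {a} {d = 0} a≼b 0∣b = subst (MaxBelowMin _≼_ a) (0∣⇒≡0 0∣b) a≼b
  maxBelowMin-∣ʳ {d = 1} _ _ = inj₁ refl
  maxBelowMin-∣ʳ {d = suc (suc _)} a≼b d∣b
    with r , minR@(pr , r∣d , _) ← minPrimeDiv (s≤s (s≤s z≤n)) | a≼b
  ... | inj₁ refl = ⊥-elim (prime∤1 pr (∣-trans r∣d d∣b))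
  ... | inj₂ (P , _ , maxP@(pP , P∣a , _) , _) =
    inj₂ (P , r , maxP , minR , maxBelowMin⇒≼ a≼b pP pr P∣a (∣-trans r∣d d∣b))

  ∈L-multiple : ∀ {a b d} → b ≥ 1 → MaxBelowMin _≼_ a b → d ∣ b → InL _≼_ a (a * d)
  ∈L-multiple {d = 0} b≥1 _ 0∣b = ⊥-elim (m<n⇒n≢0 b≥1 (0∣⇒≡0 0∣b))
  ∈L-multiple {d = suc _} _ a≼b d∣b = _ , s≤s z≤n , refl , maxBelowMin-∣ʳ a≼b d∣b

  cofactor≡1 : ∀ {a a' b b' x y} → MaxBelowMin _≼_ a b → MaxBelowMin _≼_ a' b' →
               Coprime x y → x ∣ a → y ∣ a' → x ∣ b' → y ∣ b → x ≡ 1 ⊎ y ≡ 1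
  cofactor≡1 {x = 0} {y} _ _ x⊥y _ _ _ _ = inj₂ (x⊥y (y ∣0 , ∣-refl))
  cofactor≡1 {x = x} {0} _ _ x⊥y _ _ _ _ = inj₁ (x⊥y (∣-refl , x ∣0))
  cofactor≡1 {x = 1} _ _ _ _ _ _ _ = inj₁ refl
  cofactor≡1 {y = 1} _ _ _ _ _ _ _ = inj₂ refl
  cofactor≡1 {x = suc (suc _)} {suc (suc _)} a≼b a'≼b' x⊥y x∣a y∣a' x∣b' y∣b
    with q , pq , q∣x , _ ← minPrimeDiv (s≤s (s≤s z≤n))
    with r , pr , r∣y , _ ← minPrimeDiv (s≤s (s≤s z≤n))
    = ⊥-elim (¬prime[1] (subst Prime (x⊥y (q∣x , subst (_∣ _) (sym q≡r) r∣y)) pq))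
    where
    q≡r : q ≡ r
    q≡r = ≼-antisym pq pr
      (maxBelowMin⇒≼ a≼b pq pr (∣-trans q∣x x∣a) (∣-trans r∣y y∣b))
      (maxBelowMin⇒≼ a'≼b' pr pq (∣-trans r∣y y∣a') (∣-trans q∣x x∣b'))

lemma1 : (_≼_ : ℕ → ℕ → Set) → LinearOrderOnPrimes _≼_ →
         (a a' : ℕ) → a ≥ 2 → a' ≥ 2 →
         (∃ λ n → InL _≼_ a n × InL _≼_ a' n) →
         InL _≼_ a' a ⊎ InL _≼_ a a'
lemma1 _≼_ ≼-linear a a' a≥2 _ (n , (b , b≥1 , n≡ab , a≼b) , (b' , b'≥1 , n≡a'b' , a'≼b'))
  with x , y , x⊥y , x∣a , y∣a' , x∣b' , y∣b , ay≡a'x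
         ← coprime-cofactors a a' {{>-nonZero (<⇒≤ a≥2)}} (trans (sym n≡ab) n≡a'b')
  with cofactor≡1 ≼-linear a≼b a'≼b' x⊥y x∣a y∣a' x∣b' y∣b
... | inj₁ refl =
  inj₂ (subst (InL _≼_ a) (trans ay≡a'x (*-identityʳ a')) (∈L-multiple ≼-linear b≥1 a≼b y∣b))
... | inj₂ refl =
  inj₁ (subst (InL _≼_ a') (trans (sym ay≡a'x) (*-identityʳ a)) (∈L-multiple ≼-linear b'≥1 a'≼b' x∣b'))
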